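{- Let $Q=(q_n)_{n\ge1}$ be a basic sequence that is infinite in limit, with associated sequence $(l_j)_{j\ge1}$, and set $$\bar\varepsilon_i=\frac{\left(\sum_{j=1}^i 2l_j\right)+i+1}{\left(\sum_{j=1}^i jl_j\right)+i+1}.$$ Then $\lim_{i\to\infty}\bar\varepsilon_i=0$.
   Context: A basic sequence is a sequence $Q=(q_n)_{n\ge1}$ of integers with $q_n\ge 2$; it is infinite in limit if $q_n\to\infty$. For each positive integer $j$ let $\nu_j=\min\{N: q_m\ge 2j^2 \text{ for all } m\ge N\}$. Let $l_1=\max(\nu_2-1,1)$ and, recursively for $i\ge2$, let $l_i$ be the smallest positive integer $k$ with $l_1+2l_2+\cdots+(i-1)l_{i-1}+ik\ge \nu_{i+1}-1$. -}

module Defs where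

open import Data.Nat using (ℕ; zero; suc; _+_; _*_; _∸_; _≤_; _⊔_)
open import Data.Integer using (+_)
open import Data.Rational using (ℚ; _/_)
open import Data.Product using (∃; _×_)
open import Relation.Binary.PropositionalEquality using (_≡_)

sumTo : (ℕ → ℕ) → ℕ → ℕ
sumTo f zero    = 0
sumTo f (suc i) = sumTo f i + f (suc i)

-- Q = (q_n)_{n ≥ 1} is a basic sequence (index 0 is ignored)
IsBasic : (ℕ → ℕ) → Set
IsBasic q = ∀ n → 1 ≤ n → 2 ≤ q n

InfiniteInLimit : (ℕ → ℕ) → Set
InfiniteInLimit q = ∀ M → ∃ λ N → 1 ≤ N × (∀ m → N ≤ m → M ≤ q m)

GoodFrom : (ℕ → ℕ) → ℕ → ℕ → Set
GoodFrom q j N = ∀ m → N ≤ m → 2 * (j * j) ≤ q m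

IsNu : (ℕ → ℕ) → (ℕ → ℕ) → Set
IsNu q ν = ∀ j → 1 ≤ j →
  (1 ≤ ν j) × GoodFrom q j (ν j) × (∀ N → 1 ≤ N → GoodFrom q j N → ν j ≤ N)

IsAssocL : (ℕ → ℕ) → (ℕ → ℕ) → Set
IsAssocL ν l =
  (l 1 ≡ (ν 2 ∸ 1) ⊔ 1) ×
  (∀ i → 2 ≤ i →
     let S = sumTo (λ j → j * l j) (i ∸ 1) in
     (1 ≤ l i) × (ν (suc i) ∸ 1 ≤ S + i * l i) ×
     (∀ k → 1 ≤ k → ν (suc i) ∸ 1 ≤ S + i * k → l i ≤ k))

epsBar : (ℕ → ℕ) → ℕ → ℚ
epsBar l i = (+ (sumTo (λ j → 2 * l j) i + i + 1)) / suc (sumTo (λ j → j * l j) i + i)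

module Submission where

-- Write L i = Σ_{j≤i} l_j and S i = Σ_{j≤i} j·l_j.  The numerator of
-- ε̄_i is 2·L i + i + 1 and its denominator is S i + i + 1.  The only property
-- of the associated sequence that matters is l_j ≥ 1, which gives i ≤ L i, so
-- the numerator is at most 3·L i + 1.  On the other hand S i grows much faster
-- than L i: for every cut-off K, each index j > K has weight j ≥ K, whence
-- K·L i ≤ S i + K·L K.  Choosing K = 3M + 1 and i ≥ K·L K + M gives
-- M·(numerator) < denominator, i.e. ε̄_i < 1/M.  Taking M to be the
-- denominator of a positive rational ε yields ε̄_i < ε.

open import Defs
open import Data.Nat using (ℕ; _≤_)
open import Data.Rational using (ℚ; 0ℚ; _<_)
open import Data.Product using (∃)
open import Data.Nat as ℕ using (zero; suc; _+_; _*_; _≤′_; ≤′-refl; ≤′-step; z≤n; s≤s)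
open import Data.Nat.Properties
  using ( ≤-refl; ≤-trans; ≤-reflexive; ≤⇒≤′; m≤m+n; m≤n+m; m≤n*m; m≤n⊔m; n≤1+n
        ; +-comm; +-assoc; +-mono-≤; +-monoˡ-≤; +-monoʳ-≤; *-comm; *-distribˡ-+
        ; *-monoˡ-≤; *-monoʳ-≤; ≰⇒>; _≤?_; module ≤-Reasoning)
open import Data.Integer as ℤ using (+_; -[1+_]; +<+)
import Data.Integer.Properties as ℤP
open import Data.Rational using (mkℚ; _/_; ↧_; *<*)
open import Data.Rational.Properties using (toℚᵘ-cancel-<; toℚᵘ-fromℚᵘ)
import Data.Rational.Unnormalised as ℚᵘ
import Data.Rational.Unnormalised.Properties as ℚᵘP
open import Data.Product using (_,_; proj₁)
open import Relation.Binary.PropositionalEquality using (_≡_; sym; cong; subst; subst₂)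
open import Relation.Nullary using (yes; no)
open import Data.Nat.Tactic.RingSolver using (solve-∀)

sumTo-scale : ∀ c f i → sumTo (λ j → c * f j) i ≡ c * sumTo f i
sumTo-scale c f zero    = sym (*-comm c 0)
sumTo-scale c f (suc i) rewrite sumTo-scale c f i = sym (*-distribˡ-+ c (sumTo f i) (f (suc i)))

sumTo-mono : ∀ f {i k} → i ≤ k → sumTo f i ≤ sumTo f k
sumTo-mono f i≤k = go (≤⇒≤′ i≤k)
  where
  go : ∀ {i k} → i ≤′ k → sumTo f i ≤ sumTo f k
  go ≤′-refl      = ≤-refl
  go (≤′-step i≤k) = ≤-trans (go i≤k) (m≤m+n _ _)

index≤sumTo : ∀ f → (∀ j → 1 ≤ j → 1 ≤ f j) → ∀ i → i ≤ sumTo f i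
index≤sumTo f pos zero    = z≤n
index≤sumTo f pos (suc i) =
  subst (_≤ sumTo f i + f (suc i)) (+-comm i 1) (+-mono-≤ (index≤sumTo f pos i) (pos (suc i) (s≤s z≤n)))

-- Tail estimate for the first moment: the weights l_j with j > K each
-- carry a factor j ≥ K, so K·(L i − L K) ≤ S i, stated without subtraction.
moment-tail : ∀ l K i → K * sumTo l i ≤ sumTo (λ j → j * l j) i + K * sumTo l K
moment-tail l K zero    = ≤-trans (≤-reflexive (*-comm K 0)) z≤n
moment-tail l K (suc i) with suc i ≤? K
... | yes i<K = ≤-trans (*-monoʳ-≤ K (sumTo-mono l i<K)) (m≤n+m _ _)
... | no  i≮K = begin
  K * (L i + l (suc i))                 ≡⟨ *-distribˡ-+ K (L i) (l (suc i)) ⟩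
  K * L i + K * l (suc i)               ≤⟨ +-mono-≤ (moment-tail l K i) (*-monoˡ-≤ (l (suc i)) K≤1+i) ⟩
  S i + K * L K + suc i * l (suc i)     ≡⟨ swap (S i) (K * L K) (suc i * l (suc i)) ⟩
  S i + suc i * l (suc i) + K * L K     ∎
  where
  open ≤-Reasoning
  L = sumTo l
  S = sumTo (λ j → j * l j)
  K≤1+i : K ≤ suc i
  K≤1+i = ≤-trans (n≤1+n K) (≰⇒> i≮K)
  swap : ∀ a b c → a + b + c ≡ a + c + b
  swap = solve-∀

numerator-scaled<denominator :
  ∀ l → (∀ j → 1 ≤ j → 1 ≤ l j) → ∀ M i →
  let K = suc (3 * M) in
  K * sumTo l K + M ≤ i →
  M * (sumTo (λ j → 2 * l j) i + i + 1) ℕ.< suc (sumTo (λ j → j * l j) i + i)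
numerator-scaled<denominator l pos M i i-large = s≤s (begin
  M * (sumTo (λ j → 2 * l j) i + i + 1) ≡⟨ cong (λ t → M * (t + i + 1)) (sumTo-scale 2 l i) ⟩
  M * (2 * L i + i + 1)                 ≤⟨ *-monoʳ-≤ M (+-monoˡ-≤ 1 (+-monoʳ-≤ (2 * L i) (index≤sumTo l pos i))) ⟩
  M * (2 * L i + L i + 1)               ≡⟨ expand M (L i) ⟩
  3 * M * L i + M                       ≤⟨ +-monoˡ-≤ M (*-monoˡ-≤ (L i) (n≤1+n (3 * M))) ⟩
  K * L i + M                           ≤⟨ +-monoˡ-≤ M (moment-tail l K i) ⟩
  S i + K * L K + M                     ≡⟨ +-assoc (S i) (K * L K) M ⟩
  S i + (K * L K + M)                   ≤⟨ +-monoʳ-≤ (S i) i-large ⟩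
  S i + i                               ∎)
  where
  open ≤-Reasoning
  K = suc (3 * M)
  L = sumTo l
  S = sumTo (λ j → j * l j)
  expand : ∀ m x → m * (2 * x + x + 1) ≡ 3 * m * x + m
  expand = solve-∀

-- A fraction A / (b + 1) of naturals is below a positive rational ε as soon
-- as A times the denominator of ε is below b + 1 (then A/(b+1) < 1/↧ε ≤ ε).
fraction<positive : ∀ ε → 0ℚ < ε → ∀ A b → ℤ.∣ ↧ ε ∣ * A ℕ.< suc b → (+ A) / suc b < ε
fraction<positive (mkℚ (+ zero)   _ _) (*<* (+<+ ()))
fraction<positive (mkℚ -[1+ _ ]   _ _) (*<* ())
fraction<positive (mkℚ (+ suc n) d _) _ A b dA<b+1 =
  toℚᵘ-cancel-< (ℚᵘP.<-respˡ-≃ (ℚᵘP.≃-sym (toℚᵘ-fromℚᵘ (ℚᵘ.mkℚᵘ (+ A) b)))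
    (ℚᵘ.*<* (subst₂ ℤ._<_ (ℤP.pos-* A (suc d)) (ℤP.pos-* (suc n) (suc b)) (+<+ cross))))
  where
  cross : A * suc d ℕ.< suc n * suc b
  cross = ≤-trans (s≤s (≤-reflexive (*-comm A (suc d)))) (≤-trans dA<b+1 (m≤n*m (suc b) (suc n)))

assocL-positive : ∀ {ν l} → IsAssocL ν l → ∀ j → 1 ≤ j → 1 ≤ l j
assocL-positive (l₁≡ , _)  (suc zero)    _ = subst (1 ≤_) (sym l₁≡) (m≤n⊔m _ 1)
assocL-positive (_ , lᵢ)   (suc (suc j)) _ = proj₁ (lᵢ (suc (suc j)) (s≤s (s≤s z≤n)))

mainTheorem15 : (q ν l : ℕ → ℕ) → IsBasic q → InfiniteInLimit q →
    IsNu q ν → IsAssocL ν l →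
    ∀ (ε : ℚ) → 0ℚ < ε → ∃ λ N → ∀ i → N ≤ i → epsBar l i < ε
mainTheorem15 q ν l _ _ _ assocL ε ε>0 = N , ε̄ᵢ<ε
  where
  M = ℤ.∣ ↧ ε ∣
  K = suc (3 * M)
  N = K * sumTo l K + M
  ε̄ᵢ<ε : ∀ i → N ≤ i → epsBar l i < ε
  ε̄ᵢ<ε i N≤i = fraction<positive ε ε>0 _ _
    (numerator-scaled<denominator l (assocL-positive {ν} assocL) M i N≤i)
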